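{- Let $(N,\mathcal{W})$ be a strong simple game on $n$ players, and let $\mathcal{L}=2^N\setminus\mathcal{W}$ be its family of losing coalitions. Then $\nu(N,\mathcal{W})\le z_B(\mathcal{L},n)$.
   Context: A simple game $(N,\mathcal{W})$: $N$ a finite set with $|N|=n$, $\mathcal{W}$ a family of subsets (winning coalitions) with $\emptyset\notin\mathcal{W}$, $N\in\mathcal{W}$, closed under supersets. It is strong if the complement $N\setminus T$ of every losing coalition $T$ is winning. $\nu(N,\mathcal{W})$ is the minimum number of winning coalitions with empty intersection ($\infty$ if none). For a family $P$ of subsets of $N$ (patterns, identified with incidence vectors in $\{0,1\}^n$), $z_B(P,n)$ is the minimum of $\sum_{a\in P}x_a$ over $x\in\{0,1\}^{P}$ with $\sum_{a\in P}x_a a=\mathbf{1}$ (the all-ones vector), i.e. the minimum number of members of $P$ forming a partition of $N$; it is $\infty$ if no such $x$ exists. -}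

module Defs where

open import Level using (Level; suc; _⊔_)
open import Data.Nat using (ℕ; _≤_)
open import Data.Bool using (Bool; true; false)
open import Data.Fin using (Fin)
open import Data.Fin.Subset using (Subset; ⊤; ⊥; ∁; _∩_; _⊆_; Empty)
open import Data.Vec using (lookup)
open import Data.List using (List; length; foldr; map)
open import Data.Nat.ListAction using (sum)
open import Data.List.Relation.Unary.All using (All)
open import Data.Product using (Σ; ∃; _×_; _,_)
open import Relation.Nullary using (¬_)
open import Relation.Binary.PropositionalEquality using (_≡_)

record IsSimpleGame {ℓ : Level} (n : ℕ) (W : Subset n → Set ℓ) : Set ℓ where
  field
    empty-losing  : ¬ W ⊥
    grand-winning : W ⊤
    monotone      : ∀ {S T : Subset n} → S ⊆ T → W S → W T

IsStrong : {ℓ : Level} (n : ℕ) (W : Subset n → Set ℓ) → Set ℓ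
IsStrong n W = ∀ (T : Subset n) → ¬ W T → W (∁ T)

Losing : {ℓ : Level} {n : ℕ} (W : Subset n → Set ℓ) → Subset n → Set ℓ
Losing W S = ¬ W S

⋂ : {n : ℕ} → List (Subset n) → Subset n
⋂ = foldr _∩_ ⊤

NuWitness : {ℓ : Level} {n : ℕ} (W : Subset n → Set ℓ) → ℕ → Set ℓ
NuWitness W m = Σ (List _) λ Cs → length Cs ≡ m × All W Cs × Empty (⋂ Cs)

indicator : {n : ℕ} → Subset n → Fin n → ℕ
indicator S i with lookup S i
... | true  = 1
... | false = 0

IsExactCover : {n : ℕ} → List (Subset n) → Set
IsExactCover Ps = ∀ i → sum (map (λ S → indicator S i) Ps) ≡ 1

-- z_B-witness of size k for pattern family P: k members of P (x ∈ {0,1}^P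
-- with Σ x_a = k) whose incidence vectors sum to the all-ones vector.
ZBWitness : {ℓ : Level} {n : ℕ} (P : Subset n → Set ℓ) → ℕ → Set ℓ
ZBWitness P k = Σ (List _) λ Ps → length Ps ≡ k × All P Ps × IsExactCover Ps

-- ν(N,W) ≤ z_B(P,n), for values in ℕ ∪ {∞} defined as minima:
-- whenever z_B is attained by some k (finite), ν is attained by some m ≤ k.
-- (If z_B = ∞ the inequality holds trivially.)
ν≤zB : {ℓ₁ ℓ₂ : Level} {n : ℕ} (W : Subset n → Set ℓ₁) (P : Subset n → Set ℓ₂) → Set (ℓ₁ ⊔ ℓ₂)
ν≤zB W P = ∀ k → ZBWitness P k → ∃ λ m → m ≤ k × NuWitness W m

-- The complements of the blocks of a partition of N into losing coalitions are
-- winning by strength, and they have empty intersection because every player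
-- lies in some block and hence misses its complement.
module Submission where

open import Defs
open import Data.Nat using (ℕ)
open import Data.Nat.Properties using (≤-refl; 1+n≢0)
open import Data.Bool using (true; false)
open import Data.Empty using (⊥-elim)
open import Data.Fin using (Fin)
open import Data.Fin.Subset using (Subset; _∈_; _∉_; ∁; Empty)
open import Data.Fin.Subset.Properties using (_∈?_; x∈∁p⇒x∉p; x∈p∩q⁻)
open import Data.Vec using (lookup)
open import Data.Vec.Properties using (lookup⇒[]=)
open import Data.List using (List; []; _∷_; map)
open import Data.List.Properties using (length-map)
open import Data.Nat.ListAction using (sum)
import Data.List.Relation.Unary.All as All
open import Data.List.Relation.Unary.All.Properties using (map⁺)
open import Data.List.Relation.Unary.Any using (Any; here; there)
open import Data.Product using (_,_; proj₁; proj₂)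
open import Relation.Nullary using (yes; no)
open import Relation.Binary.PropositionalEquality using (_≡_; _≢_; refl; sym; trans)

indicator-∉ : ∀ {n} {S : Subset n} {i : Fin n} → i ∉ S → indicator S i ≡ 0
indicator-∉ {S = S} {i} i∉S with lookup S i in eq
... | true  = ⊥-elim (i∉S (lookup⇒[]= i S eq))
... | false = refl

sum-indicator≢0⇒∈-some : ∀ {n} (Ps : List (Subset n)) (i : Fin n) →
                         sum (map (λ S → indicator S i) Ps) ≢ 0 → Any (i ∈_) Ps
sum-indicator≢0⇒∈-some []       i ≢0 = ⊥-elim (≢0 refl)
sum-indicator≢0⇒∈-some (P ∷ Ps) i ≢0 with i ∈? P
... | yes i∈P = here i∈P
... | no  i∉P rewrite indicator-∉ i∉P = there (sum-indicator≢0⇒∈-some Ps i ≢0)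

exactCover⇒∈-some : ∀ {n} (Ps : List (Subset n)) → IsExactCover Ps → ∀ i → Any (i ∈_) Ps
exactCover⇒∈-some Ps exact i =
  sum-indicator≢0⇒∈-some Ps i λ ≡0 → 1+n≢0 (trans (sym (exact i)) ≡0)

∈-some⇒∉⋂-map-∁ : ∀ {n} {Ps : List (Subset n)} {i : Fin n} →
                   Any (i ∈_) Ps → i ∉ ⋂ (map ∁ Ps)
∈-some⇒∉⋂-map-∁ {Ps = P ∷ Ps} (here i∈P) i∈⋂ =
  x∈∁p⇒x∉p (proj₁ (x∈p∩q⁻ (∁ P) (⋂ (map ∁ Ps)) i∈⋂)) i∈P
∈-some⇒∉⋂-map-∁ {Ps = P ∷ Ps} (there i∈Ps) i∈⋂ =
  ∈-some⇒∉⋂-map-∁ i∈Ps (proj₂ (x∈p∩q⁻ (∁ P) (⋂ (map ∁ Ps)) i∈⋂))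

covering⇒⋂-map-∁-empty : ∀ {n} (Ps : List (Subset n)) →
                          (∀ i → Any (i ∈_) Ps) → Empty (⋂ (map ∁ Ps))
covering⇒⋂-map-∁-empty _ covers (i , i∈⋂) = ∈-some⇒∉⋂-map-∁ (covers i) i∈⋂

lemma9 : (n : ℕ) (W : Subset n → Set) →
         IsSimpleGame n W → IsStrong n W → ν≤zB W (Losing W)
lemma9 n W _ strong k (Ps , |Ps|≡k , losing , exact) =
  k , ≤-refl , map ∁ Ps ,
  trans (length-map ∁ Ps) |Ps|≡k ,
  map⁺ (All.map (λ {T} → strong T) losing) ,
  covering⇒⋂-map-∁-empty Ps (exactCover⇒∈-some Ps exact)
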